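{- Let $f$ be a non-degenerate symmetric signature of arity $n\ge 3$. Then: (1) if $f\in\mathscr{P}_1$, then $\theta(f)=0$; (2) if $f\in\mathscr{A}_2$, then $\theta(f)=-1$; (3) if $f\in\mathscr{A}_3$, then $\theta(f)=-\tfrac12$.
   Context: A symmetric signature of arity $n$ is a symmetric tensor $f\in(\mathbb{C}^2)^{\otimes n}$, equivalently a function $\{0,1\}^n\to\mathbb{C}$ depending only on Hamming weight. It is degenerate if $f=u^{\otimes n}$ for some $u\in\mathbb{C}^2$, and non-degenerate otherwise. A $2\times 2$ matrix $M$ acts on $f$ via $M^{\otimes n}f$. $\mathbf{O}_2(\mathbb{C})=\{H\in\mathbb{C}^{2\times2}:HH^{\mathsf T}=I\}$. Let $\alpha=e^{i\pi/4}=\frac{1+i}{\sqrt2}$. For linearly independent $v_0=(a_0,b_0)^{\mathsf T}$ and $v_1=(a_1,b_1)^{\mathsf T}$, set $\theta(v_0,v_1)=\left(\frac{a_0a_1+b_0b_1}{a_1b_0-a_0b_1}\right)^2$. If a signature $f$ of arity $n\ge3$ can be written as $f=v_0^{\otimes n}+v_1^{\otimes n}$ with $v_0,v_1$ linearly independent, then $\theta(f):=\theta(v_0,v_1)$. This is well defined, since such an expression is unique up to multiplying $v_0$ and $v_1$ by $n$-th roots of unity and swapping them. The sets of arity-$n$ symmetric signatures are as follows. - $\mathscr{P}_1$ is the set of $f$ such that $f=cH^{\otimes n}\big((1,1)^{\otimes n}+\beta(1,-1)^{\otimes n}\big)$ for some $H\in\mathbf{O}_2(\mathbb{C})$, some $c\ne0$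 and some $\beta\ne0$. - $\mathscr{A}_2$ is the set of $f$ such that $f=cH^{\otimes n}\big((1,i)^{\otimes n}+(1,-i)^{\otimes n}\big)$ for some $H\in\mathbf{O}_2(\mathbb{C})$ and some $c\ne0$. - $\mathscr{A}_3$ is the set of $f$ such that $f=cH^{\otimes n}\big((1,\alpha)^{\otimes n}+i^r(1,-\alpha)^{\otimes n}\big)$ for some $H\in\mathbf{O}_2(\mathbb{C})$, some $c\ne0$ and some $r\in\{0,1,2,3\}$. Here vectors such as $(1,i)$ are column vectors in $\mathbb{C}^2$. -}

module Defs where

open import Level using (_⊔_)
open import Data.Nat using (ℕ; zero; suc)
open import Data.Bool using (Bool; true; false)
open import Data.Vec using (Vec; []; _∷_)
open import Data.Product using (Σ; _×_; _,_)
open import Relation.Nullary using (¬_)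
open import Algebra.Bundles using (CommutativeRing)
open import Data.Fin using (Fin; toℕ)
open import Relation.Binary.PropositionalEquality using (_≡_)

module RingOps {c ℓ} (R : CommutativeRing c ℓ) where
  open CommutativeRing R

  natC : ℕ → Carrier
  natC zero    = 0#
  natC (suc n) = 1# + natC n

  pow : Carrier → ℕ → Carrier
  pow x zero    = 1#
  pow x (suc n) = x * pow x n

  evalPoly : ∀ {m} → Vec Carrier m → Carrier → Carrier
  evalPoly []       x = 0#
  evalPoly (a ∷ as) x = a + x * evalPoly as x


-- An algebraically closed field of characteristic 0, playing the role of ℂ.
-- (ℂ is such a field; the statement is proved for every such field.)
record ComplexField (c ℓ : Level.Level) : Set (Level.suc (c ⊔ ℓ)) where
  field
    commutativeRing : CommutativeRing c ℓ
  open CommutativeRing commutativeRing public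
  field
    _⁻¹     : Carrier → Carrier
    inverse : ∀ x → ¬ (x ≈ 0#) → (x * (x ⁻¹)) ≈ 1#

  field
    char0     : ∀ n → ¬ (RingOps.natC commutativeRing (suc n) ≈ 0#)
    algClosed : ∀ m (cs : Vec Carrier (suc m)) →
                Σ Carrier (λ x → (RingOps.pow commutativeRing x (suc m)
                         + RingOps.evalPoly commutativeRing cs x) ≈ 0#)
  open RingOps commutativeRing public

module Signatures {c ℓ} (K : ComplexField c ℓ) where
  open ComplexField K hiding (zero)

  -- vectors in K² : false ↦ first coordinate, true ↦ second coordinate
  Vec₂ : Set c
  Vec₂ = Bool → Carrier

  vec2 : Carrier → Carrier → Vec₂
  vec2 a b false = a
  vec2 a b true  = b

  -- 2×2 matrices: M row column
  Mat₂ : Set c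
  Mat₂ = Bool → Bool → Carrier

  δ : Bool → Bool → Carrier
  δ false false = 1#
  δ true  true  = 1#
  δ false true  = 0#
  δ true  false = 0#

  Orthogonal : Mat₂ → Set ℓ
  Orthogonal H = ∀ x y → ((H x false * H y false) + (H x true * H y true)) ≈ δ x y

  -- a (not necessarily symmetric) signature of arity n: a tensor in (K²)^{⊗n}
  Sig : ℕ → Set c
  Sig n = Vec Bool n → Carrier

  _≈ₛ_ : ∀ {n} → Sig n → Sig n → Set ℓ
  f ≈ₛ g = ∀ x → f x ≈ g x

  _+ₛ_ : ∀ {n} → Sig n → Sig n → Sig n
  (f +ₛ g) x = f x + g x

  _·ₛ_ : ∀ {n} → Carrier → Sig n → Sig n
  (a ·ₛ f) x = a * f x

  tensorPow : ∀ n → Vec₂ → Sig n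
  tensorPow zero    u []       = 1#
  tensorPow (suc n) u (b ∷ xs) = u b * tensorPow n u xs

  sumAll : ∀ n → Sig n → Carrier
  sumAll zero    g = g []
  sumAll (suc n) g = sumAll n (λ ys → g (false ∷ ys)) + sumAll n (λ ys → g (true ∷ ys))

  matTensor : ∀ n → Mat₂ → Vec Bool n → Vec Bool n → Carrier
  matTensor zero    M []       []       = 1#
  matTensor (suc n) M (a ∷ xs) (b ∷ ys) = M a b * matTensor n M xs ys

  act : ∀ n → Mat₂ → Sig n → Sig n
  act n M f x = sumAll n (λ y → matTensor n M x y * f y)

  weight : ∀ {n} → Vec Bool n → ℕ
  weight []           = zero
  weight (true ∷ xs)  = suc (weight xs)
  weight (false ∷ xs) = weight xs

  Symmetric : ∀ {n} → Sig n → Set ℓ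
  Symmetric {n} f = ∀ x y → weight x ≡ weight y → f x ≈ f y

  Degenerate : ∀ n → Sig n → Set (c ⊔ ℓ)
  Degenerate n f = Σ Vec₂ (λ u → f ≈ₛ tensorPow n u)

  LinIndep : Vec₂ → Vec₂ → Set (c ⊔ ℓ)
  LinIndep v₀ v₁ = ∀ (λ₀ λ₁ : Carrier) →
    (∀ b → ((λ₀ * v₀ b) + (λ₁ * v₁ b)) ≈ 0#) → (λ₀ ≈ 0#) × (λ₁ ≈ 0#)

  θ : Vec₂ → Vec₂ → Carrier
  θ v₀ v₁ = q * q
    where
      a₀ = v₀ false
      b₀ = v₀ true
      a₁ = v₁ false
      b₁ = v₁ true
      q  = ((a₀ * a₁) + (b₀ * b₁)) * (((a₁ * b₀) - (a₀ * b₁)) ⁻¹)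

  Decomp : ∀ n → Sig n → Vec₂ → Vec₂ → Set (c ⊔ ℓ)
  Decomp n f v₀ v₁ = LinIndep v₀ v₁ × (f ≈ₛ (tensorPow n v₀ +ₛ tensorPow n v₁))

  -- "θ(f) = t": θ(f) is defined (f has such a decomposition) and equals t
  -- (for every such decomposition; θ(f) is well defined).
  ThetaIs : ∀ n → Sig n → Carrier → Set (c ⊔ ℓ)
  ThetaIs n f t =
    Σ Vec₂ (λ v₀ → Σ Vec₂ (λ v₁ → Decomp n f v₀ v₁))
    × (∀ v₀ v₁ → Decomp n f v₀ v₁ → θ v₀ v₁ ≈ t)

  InP1 : ∀ n → Sig n → Set (c ⊔ ℓ)
  InP1 n f = Σ Mat₂ λ H → Σ Carrier λ k → Σ Carrier λ β →
    Orthogonal H × ¬ (k ≈ 0#) × ¬ (β ≈ 0#) ×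
    (f ≈ₛ (k ·ₛ act n H (tensorPow n (vec2 1# 1#) +ₛ (β ·ₛ tensorPow n (vec2 1# (- 1#))))))

  -- 𝒜₂ (i is the imaginary unit)
  InA2 : Carrier → ∀ n → Sig n → Set (c ⊔ ℓ)
  InA2 i n f = Σ Mat₂ λ H → Σ Carrier λ k →
    Orthogonal H × ¬ (k ≈ 0#) ×
    (f ≈ₛ (k ·ₛ act n H (tensorPow n (vec2 1# i) +ₛ tensorPow n (vec2 1# (- i)))))

  -- 𝒜₃ (i the imaginary unit, α = e^{iπ/4})
  InA3 : Carrier → Carrier → ∀ n → Sig n → Set (c ⊔ ℓ)
  InA3 i α n f = Σ Mat₂ λ H → Σ Carrier λ k → Σ (Fin 4) λ r →
    Orthogonal H × ¬ (k ≈ 0#) ×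
    (f ≈ₛ (k ·ₛ act n H (tensorPow n (vec2 1# α) +ₛ
                          (pow i (toℕ r) ·ₛ tensorPow n (vec2 1# (- α))))))

-- Each class presents f as k · H^{⊗n} (x₀^{⊗n} + β x₁^{⊗n}) with H orthogonal and x₀, x₁ = (1, ±y).
-- Taking n-th roots lᵢ of k and kβ gives f = v₀^{⊗n} + v₁^{⊗n} with vᵢ = lᵢ · H xᵢ, and
-- θ(v₀, v₁) = θ(x₀, x₁) because H preserves the dot product and multiplies determinants by det H = ±1.
-- For any other decomposition f = w₀^{⊗n} + w₁^{⊗n}, the quadratic form q(u) = det(u, v₀) det(u, v₁)
-- kills f in its first two slots; contracting the remaining n − 2 ≥ 1 slots with a vector orthogonal
-- to w₁ (resp. w₀) shows q(w₀) = q(w₁) = 0, so q is proportional to det(·, w₀) det(·, w₁).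
-- θ is the projective invariant (c₀ + c₂)² / (c₁² − 4 c₀ c₂) of either form, so both decompositions
-- give the same θ. Every step is a polynomial identity: no case split on w₀ ∥ v₀ or w₀ ∥ v₁ is needed,
-- which matters because equality in K is not decidable.

module Submission where

open import Defs
open import Algebra.Bundles using (CommutativeRing)
open import Data.Bool using (true; false)
open import Data.Fin using (toℕ)
open import Data.Integer as ℤ using (ℤ; +_; -[1+_]; _◃_; sign; ∣_∣)
import Data.Integer.Properties as ℤ
open import Data.Maybe using (Maybe; just; nothing)
open import Data.Nat as ℕ using (ℕ; zero; suc; _≤_)
import Data.Nat.Properties as ℕ
open import Data.Product using (Σ; _×_; _,_; proj₁; proj₂)
open import Data.Sign as Sign using (Sign)
open import Data.Vec using (Vec; []; _∷_; replicate)
open import Relation.Binary.PropositionalEquality using (cong)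
open import Relation.Nullary using (¬_; yes; no)

-- Equality in R is not decidable, so the ring solver normalises coefficients in ℤ and maps them into R.
module IntegerCoefficients {c ℓ} (R : CommutativeRing c ℓ) where
  open CommutativeRing R
  open import Algebra.Properties.Ring ring using (-1*x≈-x; -‿involutive; -0#≈0#; -‿+-comm)
  open import Algebra.Properties.CommutativeSemigroup +-commutativeSemigroup
    using () renaming (interchange to +-interchange)
  open import Algebra.Properties.CommutativeSemigroup *-commutativeSemigroup
    using () renaming (interchange to *-interchange)
  open import Algebra.Properties.Semiring.Mult.TCOptimised semiring
    using (1+×; ×-homo-+; ×1-homo-*) renaming (_×_ to _×′_)
  import Algebra.Solver.Ring.AlmostCommutativeRing as ACR
  open import Relation.Binary.Reasoning.Setoid setoid

  fromℤ : ℤ → Carrier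
  fromℤ (+ n)    = n ×′ 1#
  fromℤ -[1+ n ] = - (suc n ×′ 1#)

  fromSign : Sign → Carrier
  fromSign Sign.+ = 1#
  fromSign Sign.- = - 1#

  x-0≈x : ∀ x → x - 0# ≈ x
  x-0≈x x = trans (+-congˡ -0#≈0#) (+-identityʳ x)

  [x+a]-[x+b]≈a-b : ∀ x a b → (x + a) - (x + b) ≈ a - b
  [x+a]-[x+b]≈a-b x a b = begin
    (x + a) - (x + b)     ≈⟨ +-congˡ (-‿+-comm x b) ⟨
    (x + a) + (- x - b)   ≈⟨ +-interchange x a (- x) (- b) ⟩
    (x - x) + (a - b)     ≈⟨ +-congʳ (-‿inverseʳ x) ⟩
    0# + (a - b)          ≈⟨ +-identityˡ (a - b) ⟩
    a - b                 ∎

  fromℤ-⊖ : ∀ m n → fromℤ (m ℤ.⊖ n) ≈ m ×′ 1# - n ×′ 1#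
  fromℤ-⊖ zero    zero    = sym (x-0≈x 0#)
  fromℤ-⊖ zero    (suc n) = sym (+-identityˡ _)
  fromℤ-⊖ (suc m) zero    = sym (x-0≈x _)
  fromℤ-⊖ (suc m) (suc n) = begin
    fromℤ (suc m ℤ.⊖ suc n)            ≡⟨ cong fromℤ (ℤ.[1+m]⊖[1+n]≡m⊖n m n) ⟩
    fromℤ (m ℤ.⊖ n)                    ≈⟨ fromℤ-⊖ m n ⟩
    m ×′ 1# - n ×′ 1#                  ≈⟨ [x+a]-[x+b]≈a-b 1# _ _ ⟨
    (1# + m ×′ 1#) - (1# + n ×′ 1#)    ≈⟨ +-cong (1+× m 1#) (-‿cong (1+× n 1#)) ⟨
    suc m ×′ 1# - suc n ×′ 1#          ∎

  fromℤ-+ : ∀ i j → fromℤ (i ℤ.+ j) ≈ fromℤ i + fromℤ j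
  fromℤ-+ (+ m)    (+ n)    = ×-homo-+ 1# m n
  fromℤ-+ (+ m)    -[1+ n ] = fromℤ-⊖ m (suc n)
  fromℤ-+ -[1+ m ] (+ n)    = trans (fromℤ-⊖ n (suc m)) (+-comm _ _)
  fromℤ-+ -[1+ m ] -[1+ n ] = begin
    - (suc (suc (m ℕ.+ n)) ×′ 1#)        ≡⟨ cong (λ k → - (suc k ×′ 1#)) (ℕ.+-suc m n) ⟨
    - ((suc m ℕ.+ suc n) ×′ 1#)          ≈⟨ -‿cong (×-homo-+ 1# (suc m) (suc n)) ⟩
    - (suc m ×′ 1# + suc n ×′ 1#)        ≈⟨ -‿+-comm _ _ ⟨
    - (suc m ×′ 1#) + - (suc n ×′ 1#)    ∎

  fromℤ-◃ : ∀ s n → fromℤ (s ◃ n) ≈ fromSign s * n ×′ 1#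
  fromℤ-◃ s      zero    = sym (zeroʳ _)
  fromℤ-◃ Sign.+ (suc n) = sym (*-identityˡ _)
  fromℤ-◃ Sign.- (suc n) = sym (-1*x≈-x _)

  fromSign-* : ∀ s t → fromSign (s Sign.* t) ≈ fromSign s * fromSign t
  fromSign-* Sign.+ t      = sym (*-identityˡ _)
  fromSign-* Sign.- Sign.+ = sym (*-identityʳ _)
  fromSign-* Sign.- Sign.- = sym (trans (-1*x≈-x _) (-‿involutive 1#))

  fromℤ≈sign*abs : ∀ i → fromℤ i ≈ fromSign (sign i) * ∣ i ∣ ×′ 1#
  fromℤ≈sign*abs i = begin
    fromℤ i                           ≡⟨ cong fromℤ (ℤ.◃-inverse i) ⟨
    fromℤ (sign i ◃ ∣ i ∣)            ≈⟨ fromℤ-◃ (sign i) ∣ i ∣ ⟩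
    fromSign (sign i) * ∣ i ∣ ×′ 1#   ∎

  fromℤ-* : ∀ i j → fromℤ (i ℤ.* j) ≈ fromℤ i * fromℤ j
  fromℤ-* i j = begin
    fromℤ (i ℤ.* j)
      ≈⟨ fromℤ-◃ (sign i Sign.* sign j) (∣ i ∣ ℕ.* ∣ j ∣) ⟩
    fromSign (sign i Sign.* sign j) * (∣ i ∣ ℕ.* ∣ j ∣) ×′ 1#
      ≈⟨ *-cong (fromSign-* (sign i) (sign j)) (×1-homo-* ∣ i ∣ ∣ j ∣) ⟩
    (fromSign (sign i) * fromSign (sign j)) * (∣ i ∣ ×′ 1# * ∣ j ∣ ×′ 1#)
      ≈⟨ *-interchange _ _ _ _ ⟩
    (fromSign (sign i) * ∣ i ∣ ×′ 1#) * (fromSign (sign j) * ∣ j ∣ ×′ 1#)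
      ≈⟨ *-cong (fromℤ≈sign*abs i) (fromℤ≈sign*abs j) ⟨
    fromℤ i * fromℤ j
      ∎

  fromℤ-neg : ∀ i → fromℤ (ℤ.- i) ≈ - fromℤ i
  fromℤ-neg -[1+ n ]    = sym (-‿involutive _)
  fromℤ-neg (+ zero)    = sym -0#≈0#
  fromℤ-neg (+ (suc n)) = refl

  fromℤ-homomorphism : ℤ.+-*-rawRing ACR.-Raw-AlmostCommutative⟶ ACR.fromCommutativeRing R
  fromℤ-homomorphism = record
    { ⟦_⟧    = fromℤ
    ; +-homo = fromℤ-+
    ; *-homo = fromℤ-*
    ; -‿homo = fromℤ-neg
    ; 0-homo = refl
    ; 1-homo = refl
    }

  fromℤ-≈? : ∀ i j → Maybe (fromℤ i ≈ fromℤ j)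
  fromℤ-≈? i j with i ℤ.≟ j
  ... | yes i≡j = just (reflexive (cong fromℤ i≡j))
  ... | no _         = nothing

  open import Algebra.Solver.Ring ℤ.+-*-rawRing (ACR.fromCommutativeRing R) fromℤ-homomorphism fromℤ-≈? public

module Theta {c ℓ} (K : ComplexField c ℓ) where
  open ComplexField K hiding (zero)
  open Signatures K
  open IntegerCoefficients commutativeRing using (Polynomial; solve; _:=_; _:+_; _:*_; :-_; _:-_; con)
  open import Algebra.Properties.Ring ring
    using (-0#≈0#; -‿involutive)
    renaming (x∙y⁻¹≈ε⇒x≈y to x-y≈0⇒x≈y; x≈y⇒x∙y⁻¹≈ε to x≈y⇒x-y≈0)
  open import Algebra.Properties.CommutativeSemigroup *-commutativeSemigroup
    using () renaming (interchange to *-interchange; x∙yz≈y∙xz to x*yz≈y*xz; xy∙z≈xz∙y to xy*z≈xz*y)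
  open import Algebra.Properties.CommutativeSemigroup +-commutativeSemigroup
    using () renaming (interchange to +-interchange)
  open import Relation.Binary.Reasoning.Setoid setoid

  two : Carrier
  two = 1# + 1#

  four : Carrier
  four = two * two

  1≉0 : 1# ≉ 0#
  1≉0 1≈0 = char0 0 (trans (+-identityʳ 1#) 1≈0)

  two≉0 : two ≉ 0#
  two≉0 two≈0 = char0 1 (trans (+-congˡ (+-identityʳ 1#)) two≈0)


  -‿≈0 : ∀ {x} → x ≈ 0# → - x ≈ 0#
  -‿≈0 x≈0 = trans (-‿cong x≈0) -0#≈0#

  -x≈0⇒x≈0 : ∀ {x} → - x ≈ 0# → x ≈ 0#
  -x≈0⇒x≈0 {x} -x≈0 = trans (sym (-‿involutive x)) (-‿≈0 -x≈0)

  -1≉0 : - 1# ≉ 0#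
  -1≉0 -1≈0 = 1≉0 (-x≈0⇒x≈0 -1≈0)

  *-≈0ʳ : ∀ x {y} → y ≈ 0# → x * y ≈ 0#
  *-≈0ʳ x y≈0 = trans (*-congˡ y≈0) (zeroʳ x)

  *-≈0ˡ : ∀ {x} y → x ≈ 0# → x * y ≈ 0#
  *-≈0ˡ y x≈0 = trans (*-congʳ x≈0) (zeroˡ y)

  +-≈0 : ∀ {x y} → x ≈ 0# → y ≈ 0# → x + y ≈ 0#
  +-≈0 x≈0 y≈0 = trans (+-cong x≈0 y≈0) (+-identityʳ 0#)

  *-cancelˡ-≈0 : ∀ {x y} → x ≉ 0# → x * y ≈ 0# → y ≈ 0#
  *-cancelˡ-≈0 {x} {y} x≉0 xy≈0 = begin
    y                   ≈⟨ *-identityˡ y ⟨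
    1# * y              ≈⟨ *-congʳ (inverse x x≉0) ⟨
    x * x ⁻¹ * y        ≈⟨ solve 3 (λ x x⁻¹ y → x :* x⁻¹ :* y := x⁻¹ :* (x :* y)) refl x (x ⁻¹) y ⟩
    x ⁻¹ * (x * y)      ≈⟨ *-≈0ʳ (x ⁻¹) xy≈0 ⟩
    0#                  ∎

  *-cancelʳ-≈0 : ∀ {x y} → y ≉ 0# → x * y ≈ 0# → x ≈ 0#
  *-cancelʳ-≈0 {x} y≉0 xy≈0 = *-cancelˡ-≈0 y≉0 (trans (*-comm _ x) xy≈0)

  *-≉0 : ∀ {x y} → x ≉ 0# → y ≉ 0# → x * y ≉ 0#
  *-≉0 x≉0 y≉0 xy≈0 = y≉0 (*-cancelˡ-≈0 x≉0 xy≈0)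

  *-cancelʳ : ∀ {x y z} → z ≉ 0# → x * z ≈ y * z → x ≈ y
  *-cancelʳ {x} {y} {z} z≉0 xz≈yz = x-y≈0⇒x≈y x y (*-cancelˡ-≈0 z≉0 (begin
    z * (x - y)      ≈⟨ solve 3 (λ x y z → z :* (x :- y) := x :* z :- y :* z) refl x y z ⟩
    x * z - y * z    ≈⟨ x≈y⇒x-y≈0 xz≈yz ⟩
    0#               ∎))

  pow-≉0 : ∀ {x} n → x ≉ 0# → pow x n ≉ 0#
  pow-≉0 ℕ.zero    x≉0 = 1≉0
  pow-≉0 (suc n) x≉0 = *-≉0 x≉0 (pow-≉0 n x≉0)

  pow≉0⇒≉0 : ∀ {x} n → pow x (suc n) ≉ 0# → x ≉ 0#
  pow≉0⇒≉0 n xⁿ≉0 x≈0 = xⁿ≉0 (*-≈0ˡ _ x≈0)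

  evalPoly-replicate-0 : ∀ m x → evalPoly (replicate m 0#) x ≈ 0#
  evalPoly-replicate-0 ℕ.zero  x = refl
  evalPoly-replicate-0 (suc m) x = +-≈0 refl (*-≈0ʳ x (evalPoly-replicate-0 m x))

  nthRoot : ∀ m k → Σ Carrier λ x → pow x (suc m) ≈ k
  nthRoot m k with algClosed m (- k ∷ replicate m 0#)
  ... | x , xⁿ-k≈0 = x , x-y≈0⇒x≈y _ _ (trans (+-congˡ (sym constantTerm)) xⁿ-k≈0)
    where
    constantTerm : - k + x * evalPoly (replicate m 0#) x ≈ - k
    constantTerm = trans (+-congˡ (*-≈0ʳ x (evalPoly-replicate-0 m x))) (+-identityʳ (- k))

  dot : Vec₂ → Vec₂ → Carrier
  dot u v = u false * v false + u true * v true

  det : Vec₂ → Vec₂ → Carrier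
  det u v = v false * u true - u false * v true

  perp : Vec₂ → Vec₂
  perp u = vec2 (u true) (- u false)

  dot-perp : ∀ u v → dot (perp u) v ≈ det u v
  dot-perp u v = solve 4 (λ a b c d → b :* c :+ :- a :* d := c :* b :- a :* d)
    refl (u false) (u true) (v false) (v true)

  det-self : ∀ u → det u u ≈ 0#
  det-self u = solve 2 (λ a b → a :* b :- a :* b := con (+ 0)) refl (u false) (u true)

  dot-perp-self : ∀ u → dot (perp u) u ≈ 0#
  dot-perp-self u = trans (dot-perp u u) (det-self u)

  det-antisym : ∀ u v → det u v ≈ - det v u
  det-antisym u v = solve 4 (λ a b c d → c :* b :- a :* d := :- (a :* d :- c :* b))
    refl (u false) (u true) (v false) (v true)

  det≉0⇒LinIndep : ∀ {u v} → det u v ≉ 0# → LinIndep u v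
  det≉0⇒LinIndep {u} {v} d≉0 λ₀ λ₁ combination≈0 =
    *-cancelʳ-≈0 d≉0 (combination λ₀ (- v true) (v false) (solve 6 (λ l₀ l₁ a b c d →
        l₀ :* (c :* b :- a :* d) := (:- d) :* (l₀ :* a :+ l₁ :* c) :+ c :* (l₀ :* b :+ l₁ :* d))
      refl λ₀ λ₁ (u false) (u true) (v false) (v true)))
    , *-cancelʳ-≈0 d≉0 (combination λ₁ (u true) (- u false) (solve 6 (λ l₀ l₁ a b c d →
        l₁ :* (c :* b :- a :* d) := b :* (l₀ :* a :+ l₁ :* c) :+ (:- a) :* (l₀ :* b :+ l₁ :* d))
      refl λ₀ λ₁ (u false) (u true) (v false) (v true)))
    where
    combination : ∀ x p q → x * det u v ≈ p * (λ₀ * u false + λ₁ * v false) + q * (λ₀ * u true + λ₁ * v true) →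
                  x * det u v ≈ 0#
    combination x p q eq = trans eq (+-≈0 (*-≈0ʳ p (combination≈0 false)) (*-≈0ʳ q (combination≈0 true)))

  LinIndep⇒det≉0 : ∀ {u v} → LinIndep u v → det u v ≉ 0#
  LinIndep⇒det≉0 {u} {v} independent d≈0 =
    1≉0 (proj₁ (independent 1# 0# (λ b → +-≈0 (trans (*-identityˡ (u b)) (u≈0 b)) (zeroˡ (v b)))))
    where
    eliminate : ∀ b b' → v b * u b' + - u b * v b' ≈ 0#
    eliminate false false = solve 2 (λ a c → c :* a :+ :- a :* c := con (+ 0)) refl (u false) (v false)
    eliminate true  true  = solve 2 (λ b d → d :* b :+ :- b :* d := con (+ 0)) refl (u true) (v true)
    eliminate false true  = trans (solve 4 (λ a b c d → c :* b :+ :- a :* d := c :* b :- a :* d)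
      refl (u false) (u true) (v false) (v true)) d≈0
    eliminate true  false = trans (solve 4 (λ a b c d → d :* a :+ :- b :* c := :- (c :* b :- a :* d))
      refl (u false) (u true) (v false) (v true)) (-‿≈0 d≈0)
    u≈0 : ∀ b → u b ≈ 0#
    u≈0 b = -x≈0⇒x≈0 (proj₂ (independent (v b) (- u b) (eliminate b)))

  θ*det²≈dot² : ∀ u v → det u v ≉ 0# → θ u v * (det u v * det u v) ≈ dot u v * dot u v
  θ*det²≈dot² u v d≉0 = x-y≈0⇒x≈y _ _ (begin
    (N * d⁻¹) * (N * d⁻¹) * (d * d) - N * N   ≈⟨ solve 3 (λ N d⁻¹ d →
        N :* d⁻¹ :* (N :* d⁻¹) :* (d :* d) :- N :* N := N :* N :* (d :* d⁻¹ :+ con (+ 1)) :* (d :* d⁻¹ :- con (+ 1)))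
      refl N d⁻¹ d ⟩
    N * N * (d * d⁻¹ + 1#) * (d * d⁻¹ - 1#)    ≈⟨ *-≈0ʳ _ (x≈y⇒x-y≈0 (inverse d d≉0)) ⟩
    0#                                        ∎)
    where
    N = dot u v
    d = det u v
    d⁻¹ = d ⁻¹

  dot²≈t*det²⇒θ≈t : ∀ u v {t} → det u v ≉ 0# → dot u v * dot u v ≈ t * (det u v * det u v) → θ u v ≈ t
  dot²≈t*det²⇒θ≈t u v d≉0 N²≈td² = *-cancelʳ (*-≉0 d≉0 d≉0) (trans (θ*det²≈dot² u v d≉0) N²≈td²)

  cross-multiplied⇒θ≈θ : ∀ u₀ u₁ v₀ v₁ → det u₀ u₁ ≉ 0# → det v₀ v₁ ≉ 0# →
    (dot u₀ u₁ * dot u₀ u₁) * (det v₀ v₁ * det v₀ v₁) ≈ (dot v₀ v₁ * dot v₀ v₁) * (det u₀ u₁ * det u₀ u₁) →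
    θ u₀ u₁ ≈ θ v₀ v₁
  cross-multiplied⇒θ≈θ u₀ u₁ v₀ v₁ du≉0 dv≉0 cross =
    dot²≈t*det²⇒θ≈t u₀ u₁ du≉0 (*-cancelʳ (*-≉0 dv≉0 dv≉0) (begin
    Nu² * dv²              ≈⟨ cross ⟩
    Nv² * du²              ≈⟨ *-congʳ (θ*det²≈dot² v₀ v₁ dv≉0) ⟨
    (θ v₀ v₁ * dv²) * du²  ≈⟨ xy*z≈xz*y (θ v₀ v₁) dv² du² ⟩
    (θ v₀ v₁ * du²) * dv²  ∎))
    where
    Nu² = dot u₀ u₁ * dot u₀ u₁
    Nv² = dot v₀ v₁ * dot v₀ v₁
    du² = det u₀ u₁ * det u₀ u₁
    dv² = det v₀ v₁ * det v₀ v₁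

  _·ᵥ_ : Carrier → Vec₂ → Vec₂
  (l ·ᵥ u) b = l * u b

  _*ᵥ_ : Mat₂ → Vec₂ → Vec₂
  (H *ᵥ u) b = H b false * u false + H b true * u true

  transpose : Mat₂ → Mat₂
  transpose H x y = H y x

  detₘ : Mat₂ → Carrier
  detₘ H = H false false * H true true - H false true * H true false

  dot-·ᵥ : ∀ l₀ l₁ u v → dot (l₀ ·ᵥ u) (l₁ ·ᵥ v) ≈ (l₀ * l₁) * dot u v
  dot-·ᵥ l₀ l₁ u v = solve 6 (λ l₀ l₁ a b c d → l₀ :* a :* (l₁ :* c) :+ l₀ :* b :* (l₁ :* d) := l₀ :* l₁ :* (a :* c :+ b :* d))
    refl l₀ l₁ (u false) (u true) (v false) (v true)

  det-·ᵥ : ∀ l₀ l₁ u v → det (l₀ ·ᵥ u) (l₁ ·ᵥ v) ≈ (l₀ * l₁) * det u v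
  det-·ᵥ l₀ l₁ u v = solve 6 (λ l₀ l₁ a b c d → l₁ :* c :* (l₀ :* b) :- l₀ :* a :* (l₁ :* d) := l₀ :* l₁ :* (c :* b :- a :* d))
    refl l₀ l₁ (u false) (u true) (v false) (v true)

  det-*ᵥ : ∀ H u v → det (H *ᵥ u) (H *ᵥ v) ≈ detₘ H * det u v
  det-*ᵥ H u v = solve 8 (λ a b c d p q r s →
      (a :* r :+ b :* s) :* (c :* p :+ d :* q) :- (a :* p :+ b :* q) :* (c :* r :+ d :* s) := (a :* d :- b :* c) :* (r :* q :- p :* s))
    refl (H false false) (H false true) (H true false) (H true true) (u false) (u true) (v false) (v true)

  module _ {H : Mat₂} (H-orth : Orthogonal H) where
    private
      h₀₀ = H false false
      h₀₁ = H false true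
      h₁₀ = H true false
      h₁₁ = H true true
      row₁ : h₀₀ * h₀₀ + h₀₁ * h₀₁ - 1# ≈ 0#
      row₁ = x≈y⇒x-y≈0 (H-orth false false)
      row₂ : h₁₀ * h₁₀ + h₁₁ * h₁₁ - 1# ≈ 0#
      row₂ = x≈y⇒x-y≈0 (H-orth true true)
      rows : h₀₀ * h₁₀ + h₀₁ * h₁₁ ≈ 0#
      rows = H-orth false true

    detₘ²≈1 : detₘ H * detₘ H ≈ 1#
    detₘ²≈1 = x-y≈0⇒x≈y _ _ (trans
      (solve 4 (λ a b c d →
          let R₁ = a :* a :+ b :* b :- con (+ 1)
              R₂ = c :* c :+ d :* d :- con (+ 1)
              R₃ = a :* c :+ b :* d
              D = a :* d :- b :* c
          in D :* D :- con (+ 1) := R₁ :* R₂ :+ R₁ :+ (R₂ :+ (:- R₃) :* R₃))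
        refl h₀₀ h₀₁ h₁₀ h₁₁)
      (+-≈0 (+-≈0 (*-≈0ˡ _ row₁) row₁) (+-≈0 row₂ (*-≈0ʳ _ rows))))

    -- Each entry of HᵀH − I is a combination of the entries of HHᵀ − I and of det(H)² − 1.
    private
      column₁ : h₀₀ * h₀₀ + h₁₀ * h₁₀ ≈ 1#
      column₁ = x-y≈0⇒x≈y _ _ (trans
        (solve 4 (λ a b c d →
            let R₁ = a :* a :+ b :* b :- con (+ 1)
                R₂ = c :* c :+ d :* d :- con (+ 1)
                R₃ = a :* c :+ b :* d
                D = a :* d :- b :* c
            in a :* a :+ c :* c :- con (+ 1)
                 := a :* ((:- a) :* R₂ :+ c :* R₃) :+ c :* ((:- c) :* R₁ :+ a :* R₃) :+ (D :* D :- con (+ 1)))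
          refl h₀₀ h₀₁ h₁₀ h₁₁)
        (+-≈0 (+-≈0 (*-≈0ʳ h₀₀ (+-≈0 (*-≈0ʳ _ row₂) (*-≈0ʳ h₁₀ rows)))
                    (*-≈0ʳ h₁₀ (+-≈0 (*-≈0ʳ _ row₁) (*-≈0ʳ h₀₀ rows))))
              (x≈y⇒x-y≈0 detₘ²≈1)))
      column₂ : h₀₁ * h₀₁ + h₁₁ * h₁₁ ≈ 1#
      column₂ = x-y≈0⇒x≈y _ _ (trans
        (solve 4 (λ a b c d →
            let R₁ = a :* a :+ b :* b :- con (+ 1)
                R₂ = c :* c :+ d :* d :- con (+ 1)
                R₃ = a :* c :+ b :* d
                D = a :* d :- b :* c
            in b :* b :+ d :* d :- con (+ 1)
                 := b :* ((:- b) :* R₂ :+ d :* R₃) :+ d :* ((:- d) :* R₁ :+ b :* R₃) :+ (D :* D :- con (+ 1)))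
          refl h₀₀ h₀₁ h₁₀ h₁₁)
        (+-≈0 (+-≈0 (*-≈0ʳ h₀₁ (+-≈0 (*-≈0ʳ _ row₂) (*-≈0ʳ h₁₁ rows)))
                    (*-≈0ʳ h₁₁ (+-≈0 (*-≈0ʳ _ row₁) (*-≈0ʳ h₀₁ rows))))
              (x≈y⇒x-y≈0 detₘ²≈1)))
      columns : h₀₀ * h₀₁ + h₁₀ * h₁₁ ≈ 0#
      columns = trans
        (solve 4 (λ a b c d →
            let R₁ = a :* a :+ b :* b :- con (+ 1)
                R₂ = c :* c :+ d :* d :- con (+ 1)
                R₃ = a :* c :+ b :* d
            in a :* b :+ c :* d := a :* ((:- b) :* R₂ :+ d :* R₃) :+ c :* ((:- d) :* R₁ :+ b :* R₃))
          refl h₀₀ h₀₁ h₁₀ h₁₁)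
        (+-≈0 (*-≈0ʳ h₀₀ (+-≈0 (*-≈0ʳ _ row₂) (*-≈0ʳ h₁₁ rows)))
              (*-≈0ʳ h₁₀ (+-≈0 (*-≈0ʳ _ row₁) (*-≈0ʳ h₀₁ rows))))

    Orthogonal-transpose : Orthogonal (transpose H)
    Orthogonal-transpose false false = column₁
    Orthogonal-transpose true  true  = column₂
    Orthogonal-transpose false true  = columns
    Orthogonal-transpose true  false = trans (+-cong (*-comm h₀₁ h₀₀) (*-comm h₁₁ h₁₀)) columns

    dot-*ᵥ : ∀ u v → dot (H *ᵥ u) (H *ᵥ v) ≈ dot u v
    dot-*ᵥ u v = x-y≈0⇒x≈y _ _ (trans
      (solve 8 (λ a b c d p q r s →
          let C₁ = a :* a :+ c :* c :- con (+ 1); C₂ = b :* b :+ d :* d :- con (+ 1); C₃ = a :* b :+ c :* d in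
          (a :* p :+ b :* q) :* (a :* r :+ b :* s) :+ (c :* p :+ d :* q) :* (c :* r :+ d :* s) :- (p :* r :+ q :* s)
            := p :* r :* C₁ :+ (p :* s :+ q :* r) :* C₃ :+ q :* s :* C₂)
        refl h₀₀ h₀₁ h₁₀ h₁₁ (u false) (u true) (v false) (v true))
      (+-≈0 (+-≈0 (*-≈0ʳ _ (x≈y⇒x-y≈0 (Orthogonal-transpose false false))) (*-≈0ʳ _ (Orthogonal-transpose false true)))
            (*-≈0ʳ _ (x≈y⇒x-y≈0 (Orthogonal-transpose true true)))))

    detₘ≉0 : detₘ H ≉ 0#
    detₘ≉0 D≈0 = 1≉0 (trans (sym detₘ²≈1) (*-≈0ˡ _ D≈0))

    module _ (u v : Vec₂) {l₀ l₁} (l₀≉0 : l₀ ≉ 0#) (l₁≉0 : l₁ ≉ 0#) (d≉0 : det u v ≉ 0#) where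
      private
        P = l₀ * l₁
        D = detₘ H
        N = dot u v
        d = det u v
        N' = dot (l₀ ·ᵥ (H *ᵥ u)) (l₁ ·ᵥ (H *ᵥ v))
        d' = det (l₀ ·ᵥ (H *ᵥ u)) (l₁ ·ᵥ (H *ᵥ v))
        N'≈PN : N' ≈ P * N
        N'≈PN = trans (dot-·ᵥ l₀ l₁ (H *ᵥ u) (H *ᵥ v)) (*-congˡ (dot-*ᵥ u v))
        d'≈PDd : d' ≈ P * (D * d)
        d'≈PDd = trans (det-·ᵥ l₀ l₁ (H *ᵥ u) (H *ᵥ v)) (*-congˡ (det-*ᵥ H u v))

      det-·ᵥ-*ᵥ≉0 : d' ≉ 0#
      det-·ᵥ-*ᵥ≉0 d'≈0 = *-≉0 (*-≉0 l₀≉0 l₁≉0) (*-≉0 detₘ≉0 d≉0) (trans (sym d'≈PDd) d'≈0)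

      θ-·ᵥ-*ᵥ : θ (l₀ ·ᵥ (H *ᵥ u)) (l₁ ·ᵥ (H *ᵥ v)) ≈ θ u v
      θ-·ᵥ-*ᵥ = cross-multiplied⇒θ≈θ (l₀ ·ᵥ (H *ᵥ u)) (l₁ ·ᵥ (H *ᵥ v)) u v det-·ᵥ-*ᵥ≉0 d≉0 (begin
        N' * N' * (d * d)                      ≈⟨ *-congʳ (*-cong N'≈PN N'≈PN) ⟩
        P * N * (P * N) * (d * d)              ≈⟨ rearrange₁ ⟩
        N * N * (P * P * (d * d)) * 1#         ≈⟨ *-congˡ detₘ²≈1 ⟨
        N * N * (P * P * (d * d)) * (D * D)    ≈⟨ rearrange₂ ⟩
        N * N * (P * (D * d) * (P * (D * d)))  ≈⟨ *-congˡ (*-cong d'≈PDd d'≈PDd) ⟨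
        N * N * (d' * d')                      ∎)
        where
        rearrange₁ : P * N * (P * N) * (d * d) ≈ N * N * (P * P * (d * d)) * 1#
        rearrange₁ = solve 3 (λ P N d → P :* N :* (P :* N) :* (d :* d) := N :* N :* (P :* P :* (d :* d)) :* con (+ 1))
          refl P N d
        rearrange₂ : N * N * (P * P * (d * d)) * (D * D) ≈ N * N * (P * (D * d) * (P * (D * d)))
        rearrange₂ = solve 4 (λ P N d D → N :* N :* (P :* P :* (d :* d)) :* (D :* D) := N :* N :* (P :* (D :* d) :* (P :* (D :* d))))
          refl P N d D

  sumAll-cong : ∀ n {g h : Sig n} → g ≈ₛ h → sumAll n g ≈ sumAll n h
  sumAll-cong ℕ.zero  g≈h = g≈h []
  sumAll-cong (suc n) g≈h = +-cong (sumAll-cong n (λ ys → g≈h (false ∷ ys))) (sumAll-cong n (λ ys → g≈h (true ∷ ys)))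

  sumAll-+ₛ : ∀ n (g h : Sig n) → sumAll n (g +ₛ h) ≈ sumAll n g + sumAll n h
  sumAll-+ₛ ℕ.zero  g h = refl
  sumAll-+ₛ (suc n) g h = trans (+-cong (sumAll-+ₛ n _ _) (sumAll-+ₛ n _ _)) (+-interchange _ _ _ _)

  sumAll-·ₛ : ∀ n k (g : Sig n) → sumAll n (k ·ₛ g) ≈ k * sumAll n g
  sumAll-·ₛ ℕ.zero  k g = refl
  sumAll-·ₛ (suc n) k g = trans (+-cong (sumAll-·ₛ n k _) (sumAll-·ₛ n k _)) (sym (distribˡ k _ _))

  sumAll-factor : ∀ n p q (g h : Sig n) → sumAll n (λ y → (p * g y) * (q * h y)) ≈ (p * q) * sumAll n (λ y → g y * h y)
  sumAll-factor n p q g h = trans (sumAll-cong n (λ y → *-interchange p (g y) q (h y))) (sumAll-·ₛ n (p * q) _)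

  sumAll-tensorPow-* : ∀ n z u → sumAll n (λ y → tensorPow n z y * tensorPow n u y) ≈ pow (dot z u) n
  sumAll-tensorPow-* ℕ.zero  z u = *-identityˡ 1#
  sumAll-tensorPow-* (suc n) z u = begin
    sumAll n (λ y → (z false * tensorPow n z y) * (u false * tensorPow n u y))
      + sumAll n (λ y → (z true * tensorPow n z y) * (u true * tensorPow n u y))
      ≈⟨ +-cong (sumAll-factor n _ _ _ _) (sumAll-factor n _ _ _ _) ⟩
    z false * u false * S + z true * u true * S    ≈⟨ distribʳ S _ _ ⟨
    dot z u * S                                    ≈⟨ *-congˡ (sumAll-tensorPow-* n z u) ⟩
    dot z u * pow (dot z u) n                      ∎
    where
    S = sumAll n (λ y → tensorPow n z y * tensorPow n u y)

  tensorPow-·ᵥ : ∀ n l u → tensorPow n (l ·ᵥ u) ≈ₛ (pow l n ·ₛ tensorPow n u)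
  tensorPow-·ᵥ ℕ.zero  l u [] = sym (*-identityˡ 1#)
  tensorPow-·ᵥ (suc n) l u (b ∷ xs) = trans (*-congˡ (tensorPow-·ᵥ n l u xs)) (*-interchange l (u b) _ _)

  act-cong : ∀ n H {f g : Sig n} → f ≈ₛ g → act n H f ≈ₛ act n H g
  act-cong n H f≈g x = sumAll-cong n (λ y → *-congˡ (f≈g y))

  act-+ₛ : ∀ n H (f g : Sig n) → act n H (f +ₛ g) ≈ₛ (act n H f +ₛ act n H g)
  act-+ₛ n H f g x = trans (sumAll-cong n (λ y → distribˡ _ _ _)) (sumAll-+ₛ n _ _)

  act-·ₛ : ∀ n H k (f : Sig n) → act n H (k ·ₛ f) ≈ₛ (k ·ₛ act n H f)
  act-·ₛ n H k f x = trans (sumAll-cong n (λ y → x*yz≈y*xz _ k _)) (sumAll-·ₛ n k _)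

  act-tensorPow : ∀ n H u → act n H (tensorPow n u) ≈ₛ tensorPow n (H *ᵥ u)
  act-tensorPow ℕ.zero  H u [] = *-identityˡ 1#
  act-tensorPow (suc n) H u (a ∷ xs) = begin
    sumAll n (λ y → (H a false * matTensor n H xs y) * (u false * tensorPow n u y))
      + sumAll n (λ y → (H a true * matTensor n H xs y) * (u true * tensorPow n u y))
      ≈⟨ +-cong (sumAll-factor n _ _ _ _) (sumAll-factor n _ _ _ _) ⟩
    H a false * u false * act n H (tensorPow n u) xs + H a true * u true * act n H (tensorPow n u) xs
      ≈⟨ distribʳ _ _ _ ⟨
    (H *ᵥ u) a * act n H (tensorPow n u) xs        ≈⟨ *-congˡ (act-tensorPow n H u xs) ⟩
    (H *ᵥ u) a * tensorPow n (H *ᵥ u) xs           ∎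

  orthogonal-decomposition : ∀ m {H k β x₀ x₁} (f : Sig (suc m)) → Orthogonal H → k ≉ 0# → β ≉ 0# → det x₀ x₁ ≉ 0# →
    f ≈ₛ (k ·ₛ act (suc m) H (tensorPow (suc m) x₀ +ₛ (β ·ₛ tensorPow (suc m) x₁))) →
    Σ Vec₂ λ v₀ → Σ Vec₂ λ v₁ → Decomp (suc m) f v₀ v₁ × θ v₀ v₁ ≈ θ x₀ x₁
  orthogonal-decomposition m {H} {k} {β} {x₀} {x₁} f H-orth k≉0 β≉0 d≉0 f≈ =
    v₀ , v₁ , (det≉0⇒LinIndep {v₀} {v₁} (det-·ᵥ-*ᵥ≉0 {H} H-orth x₀ x₁ l₀≉0 l₁≉0 d≉0) , f≈v)
    , θ-·ᵥ-*ᵥ {H} H-orth x₀ x₁ l₀≉0 l₁≉0 d≉0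
    where
    n = suc m
    l₀ = proj₁ (nthRoot m k)
    l₁ = proj₁ (nthRoot m (k * β))
    l₀ⁿ≈k : pow l₀ n ≈ k
    l₀ⁿ≈k = proj₂ (nthRoot m k)
    l₁ⁿ≈kβ : pow l₁ n ≈ k * β
    l₁ⁿ≈kβ = proj₂ (nthRoot m (k * β))
    l₀≉0 : l₀ ≉ 0#
    l₀≉0 = pow≉0⇒≉0 m (λ l₀ⁿ≈0 → k≉0 (trans (sym l₀ⁿ≈k) l₀ⁿ≈0))
    l₁≉0 : l₁ ≉ 0#
    l₁≉0 = pow≉0⇒≉0 m (λ l₁ⁿ≈0 → *-≉0 k≉0 β≉0 (trans (sym l₁ⁿ≈kβ) l₁ⁿ≈0))
    v₀ = l₀ ·ᵥ (H *ᵥ x₀)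
    v₁ = l₁ ·ᵥ (H *ᵥ x₁)
    f≈v : f ≈ₛ (tensorPow n v₀ +ₛ tensorPow n v₁)
    f≈v x = begin
      f x
        ≈⟨ f≈ x ⟩
      k * act n H (tensorPow n x₀ +ₛ (β ·ₛ tensorPow n x₁)) x
        ≈⟨ *-congˡ (trans (act-+ₛ n H (tensorPow n x₀) (β ·ₛ tensorPow n x₁) x) (+-cong (act-tensorPow n H x₀ x)
                     (trans (act-·ₛ n H β (tensorPow n x₁) x) (*-congˡ (act-tensorPow n H x₁ x))))) ⟩
      k * (tensorPow n (H *ᵥ x₀) x + β * tensorPow n (H *ᵥ x₁) x)
        ≈⟨ trans (distribˡ k _ _) (+-congˡ (sym (*-assoc k β _))) ⟩
      k * tensorPow n (H *ᵥ x₀) x + k * β * tensorPow n (H *ᵥ x₁) x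
        ≈⟨ +-cong (*-congʳ l₀ⁿ≈k) (*-congʳ l₁ⁿ≈kβ) ⟨
      pow l₀ n * tensorPow n (H *ᵥ x₀) x + pow l₁ n * tensorPow n (H *ᵥ x₁) x
        ≈⟨ +-cong (tensorPow-·ᵥ n l₀ _ x) (tensorPow-·ᵥ n l₁ _ x) ⟨
      tensorPow n v₀ x + tensorPow n v₁ x
        ∎

  record Form : Set c where
    constructor form
    field
      c₀ c₁ c₂ : Carrier

  _⟨_⟩ : Form → Vec₂ → Carrier
  form c₀ c₁ c₂ ⟨ u ⟩ = c₀ * (u false * u false) + c₁ * (u false * u true) + c₂ * (u true * u true)

  formᵖ : ∀ {n} (c₀ c₁ c₂ x y : Polynomial n) → Polynomial n
  formᵖ c₀ c₁ c₂ x y = c₀ :* (x :* x) :+ c₁ :* (x :* y) :+ c₂ :* (y :* y)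

  vanishingForm : Vec₂ → Vec₂ → Form
  vanishingForm v₀ v₁ = form (v₀ true * v₁ true) (- (v₀ false * v₁ true + v₁ false * v₀ true)) (v₀ false * v₁ false)

  vanishingForm-⟨⟩ : ∀ v₀ v₁ u → vanishingForm v₀ v₁ ⟨ u ⟩ ≈ det u v₀ * det u v₁
  vanishingForm-⟨⟩ v₀ v₁ u = solve 6 (λ a₀ b₀ a₁ b₁ x y →
      formᵖ (b₀ :* b₁) (:- (a₀ :* b₁ :+ a₁ :* b₀)) (a₀ :* a₁) x y := (a₀ :* y :- x :* b₀) :* (a₁ :* y :- x :* b₁))
    refl (v₀ false) (v₀ true) (v₁ false) (v₁ true) (u false) (u true)

  vanishingForm-⟨₀⟩ : ∀ v₀ v₁ → vanishingForm v₀ v₁ ⟨ v₀ ⟩ ≈ 0#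
  vanishingForm-⟨₀⟩ v₀ v₁ = trans (vanishingForm-⟨⟩ v₀ v₁ v₀) (*-≈0ˡ _ (det-self v₀))

  vanishingForm-⟨₁⟩ : ∀ v₀ v₁ → vanishingForm v₀ v₁ ⟨ v₁ ⟩ ≈ 0#
  vanishingForm-⟨₁⟩ v₀ v₁ = trans (vanishingForm-⟨⟩ v₀ v₁ v₁) (*-≈0ʳ _ (det-self v₁))

  tr : Form → Carrier
  tr (form c₀ c₁ c₂) = c₀ + c₂

  disc : Form → Carrier
  disc (form c₀ c₁ c₂) = c₁ * c₁ - four * (c₀ * c₂)

  tr-vanishingForm : ∀ v₀ v₁ → tr (vanishingForm v₀ v₁) ≈ dot v₀ v₁
  tr-vanishingForm v₀ v₁ = +-comm _ _

  disc-vanishingForm : ∀ v₀ v₁ → disc (vanishingForm v₀ v₁) ≈ det v₀ v₁ * det v₀ v₁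
  disc-vanishingForm v₀ v₁ = solve 4 (λ a₀ b₀ a₁ b₁ →
      (:- (a₀ :* b₁ :+ a₁ :* b₀)) :* (:- (a₀ :* b₁ :+ a₁ :* b₀)) :- con (+ 2) :* con (+ 2) :* (b₀ :* b₁ :* (a₀ :* a₁))
        := (a₁ :* b₀ :- a₀ :* b₁) :* (a₁ :* b₀ :- a₀ :* b₁))
    refl (v₀ false) (v₀ true) (v₁ false) (v₁ true)

  Proportional : Form → Form → Set ℓ
  Proportional (form p₀ p₁ p₂) (form q₀ q₁ q₂) = (p₁ * q₂ ≈ p₂ * q₁) × (p₂ * q₀ ≈ p₀ * q₂) × (p₀ * q₁ ≈ p₁ * q₀)

  proportional-cross : ∀ P Q → Proportional P Q → tr P * tr P * disc Q ≈ tr Q * tr Q * disc P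
  proportional-cross (form p₀ p₁ p₂) (form q₀ q₁ q₂) (m₁₂ , m₂₀ , m₀₁) = x-y≈0⇒x≈y _ _ (trans
    (solve 6 (λ p₀ p₁ p₂ q₀ q₁ q₂ → let X = (p₀ :+ p₂) :* q₁ :+ (q₀ :+ q₂) :* p₁ in
        (p₀ :+ p₂) :* (p₀ :+ p₂) :* (q₁ :* q₁ :- con (+ 2) :* con (+ 2) :* (q₀ :* q₂))
          :- (q₀ :+ q₂) :* (q₀ :+ q₂) :* (p₁ :* p₁ :- con (+ 2) :* con (+ 2) :* (p₀ :* p₂))
          := (p₀ :* q₁ :- p₁ :* q₀) :* X :+ (p₁ :* q₂ :- p₂ :* q₁) :* (:- X)
             :+ (p₂ :* q₀ :- p₀ :* q₂) :* (con (+ 4) :* (p₀ :* q₀ :- p₂ :* q₂)))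
      refl p₀ p₁ p₂ q₀ q₁ q₂)
    (+-≈0 (+-≈0 (*-≈0ˡ _ (x≈y⇒x-y≈0 m₀₁)) (*-≈0ˡ _ (x≈y⇒x-y≈0 m₁₂))) (*-≈0ˡ _ (x≈y⇒x-y≈0 m₂₀))))

  vanishing⇒proportional : ∀ Q w₀ w₁ → det w₀ w₁ ≉ 0# → Q ⟨ w₀ ⟩ ≈ 0# → Q ⟨ w₁ ⟩ ≈ 0# →
                           Proportional Q (vanishingForm w₀ w₁)
  vanishing⇒proportional (form c₀ c₁ c₂) w₀ w₁ d≉0 Q⟨w₀⟩≈0 Q⟨w₁⟩≈0 =
      minor (a₁ * a₁) (- (a₀ * a₀)) (solve 7 (λ a₀ b₀ a₁ b₁ c₀ c₁ c₂ →
          (a₁ :* b₀ :- a₀ :* b₁) :* (c₁ :* (a₀ :* a₁) :- c₂ :* (:- (a₀ :* b₁ :+ a₁ :* b₀)))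
            := a₁ :* a₁ :* formᵖ c₀ c₁ c₂ a₀ b₀ :+ (:- (a₀ :* a₀)) :* formᵖ c₀ c₁ c₂ a₁ b₁)
        refl a₀ b₀ a₁ b₁ c₀ c₁ c₂)
    , minor (a₁ * b₁) (- (a₀ * b₀)) (solve 7 (λ a₀ b₀ a₁ b₁ c₀ c₁ c₂ →
          (a₁ :* b₀ :- a₀ :* b₁) :* (c₂ :* (b₀ :* b₁) :- c₀ :* (a₀ :* a₁))
            := a₁ :* b₁ :* formᵖ c₀ c₁ c₂ a₀ b₀ :+ (:- (a₀ :* b₀)) :* formᵖ c₀ c₁ c₂ a₁ b₁)
        refl a₀ b₀ a₁ b₁ c₀ c₁ c₂)
    , minor (b₁ * b₁) (- (b₀ * b₀)) (solve 7 (λ a₀ b₀ a₁ b₁ c₀ c₁ c₂ →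
          (a₁ :* b₀ :- a₀ :* b₁) :* (c₀ :* (:- (a₀ :* b₁ :+ a₁ :* b₀)) :- c₁ :* (b₀ :* b₁))
            := b₁ :* b₁ :* formᵖ c₀ c₁ c₂ a₀ b₀ :+ (:- (b₀ :* b₀)) :* formᵖ c₀ c₁ c₂ a₁ b₁)
        refl a₀ b₀ a₁ b₁ c₀ c₁ c₂)
    where
    a₀ = w₀ false
    b₀ = w₀ true
    a₁ = w₁ false
    b₁ = w₁ true
    minor : ∀ {x y} s t → det w₀ w₁ * (x - y) ≈ s * form c₀ c₁ c₂ ⟨ w₀ ⟩ + t * form c₀ c₁ c₂ ⟨ w₁ ⟩ → x ≈ y
    minor s t eq = x-y≈0⇒x≈y _ _ (*-cancelˡ-≈0 d≉0 (trans eq (+-≈0 (*-≈0ʳ s Q⟨w₀⟩≈0) (*-≈0ʳ t Q⟨w₁⟩≈0))))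

  contract : ∀ m → Form → Vec₂ → Sig (suc (suc m)) → Carrier
  contract m (form c₀ c₁ c₂) z g =
    sumAll m (λ r → tensorPow m z r * (c₀ * g (false ∷ false ∷ r) + c₁ * g (false ∷ true ∷ r) + c₂ * g (true ∷ true ∷ r)))

  contract-cong : ∀ m Q z {g h} → g ≈ₛ h → contract m Q z g ≈ contract m Q z h
  contract-cong m (form c₀ c₁ c₂) z g≈h =
    sumAll-cong m (λ r → *-congˡ (+-cong (+-cong (*-congˡ (g≈h _)) (*-congˡ (g≈h _))) (*-congˡ (g≈h _))))

  contract-+ₛ : ∀ m Q z g h → contract m Q z (g +ₛ h) ≈ contract m Q z g + contract m Q z h
  contract-+ₛ m (form c₀ c₁ c₂) z g h = trans (sumAll-cong m (λ r → solve 10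
      (λ t c₀ c₁ c₂ g₀ g₁ g₂ h₀ h₁ h₂ → t :* (c₀ :* (g₀ :+ h₀) :+ c₁ :* (g₁ :+ h₁) :+ c₂ :* (g₂ :+ h₂))
         := t :* (c₀ :* g₀ :+ c₁ :* g₁ :+ c₂ :* g₂) :+ t :* (c₀ :* h₀ :+ c₁ :* h₁ :+ c₂ :* h₂))
      refl _ c₀ c₁ c₂ _ _ _ _ _ _))
    (sumAll-+ₛ m _ _)

  contract-tensorPow : ∀ m Q z u → contract m Q z (tensorPow (suc (suc m)) u) ≈ Q ⟨ u ⟩ * pow (dot z u) m
  contract-tensorPow m Q@(form c₀ c₁ c₂) z u = begin
    contract m Q z (tensorPow (suc (suc m)) u)
      ≈⟨ sumAll-cong m (λ r → solve 7 (λ c₀ c₁ c₂ a b t s →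
           s :* (c₀ :* (a :* (a :* t)) :+ c₁ :* (a :* (b :* t)) :+ c₂ :* (b :* (b :* t)))
             := formᵖ c₀ c₁ c₂ a b :* (s :* t))
         refl c₀ c₁ c₂ (u false) (u true) _ _) ⟩
    sumAll m (λ r → Q ⟨ u ⟩ * (tensorPow m z r * tensorPow m u r))   ≈⟨ sumAll-·ₛ m _ _ ⟩
    Q ⟨ u ⟩ * sumAll m (λ r → tensorPow m z r * tensorPow m u r)     ≈⟨ *-congˡ (sumAll-tensorPow-* m z u) ⟩
    Q ⟨ u ⟩ * pow (dot z u) m                                        ∎

  contract-decomposition : ∀ m Q z {f v₀ v₁} → f ≈ₛ (tensorPow (suc (suc m)) v₀ +ₛ tensorPow (suc (suc m)) v₁) →
                           contract m Q z f ≈ Q ⟨ v₀ ⟩ * pow (dot z v₀) m + Q ⟨ v₁ ⟩ * pow (dot z v₁) m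
  contract-decomposition m Q z {f} {v₀} {v₁} f≈ = begin
    contract m Q z f
      ≈⟨ contract-cong m Q z f≈ ⟩
    contract m Q z (tensorPow _ v₀ +ₛ tensorPow _ v₁)
      ≈⟨ contract-+ₛ m Q z (tensorPow _ v₀) (tensorPow _ v₁) ⟩
    contract m Q z (tensorPow _ v₀) + contract m Q z (tensorPow _ v₁)
      ≈⟨ +-cong (contract-tensorPow m Q z v₀) (contract-tensorPow m Q z v₁) ⟩
    Q ⟨ v₀ ⟩ * pow (dot z v₀) m + Q ⟨ v₁ ⟩ * pow (dot z v₁) m
      ∎

  -- Contracting against z = perp w₁ kills the w₁-term, leaving Q(w₀) times a nonzero power.
  vanishing-transfer : ∀ m Q {f v₀ v₁ w₀ w₁} →
    let n = suc (suc (suc m)) in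
    f ≈ₛ (tensorPow n v₀ +ₛ tensorPow n v₁) → f ≈ₛ (tensorPow n w₀ +ₛ tensorPow n w₁) →
    Q ⟨ v₀ ⟩ ≈ 0# → Q ⟨ v₁ ⟩ ≈ 0# → det w₀ w₁ ≉ 0# → Q ⟨ w₀ ⟩ ≈ 0# × Q ⟨ w₁ ⟩ ≈ 0#
  vanishing-transfer m Q {f} {v₀} {v₁} {w₀} {w₁} f≈v f≈w Q⟨v₀⟩≈0 Q⟨v₁⟩≈0 d≉0 =
      vanishes-at w₀ w₁ S≈0 (λ d₁₀≈0 → d≉0 (trans (det-antisym w₀ w₁) (-‿≈0 d₁₀≈0)))
    , vanishes-at w₁ w₀ (λ z → trans (+-comm _ _) (S≈0 z)) d≉0
    where
    S : Vec₂ → Vec₂ → Vec₂ → Carrier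
    S x₀ x₁ z = Q ⟨ x₀ ⟩ * pow (dot z x₀) (suc m) + Q ⟨ x₁ ⟩ * pow (dot z x₁) (suc m)
    S≈0 : ∀ z → S w₀ w₁ z ≈ 0#
    S≈0 z = begin
      S w₀ w₁ z                ≈⟨ contract-decomposition (suc m) Q z f≈w ⟨
      contract (suc m) Q z f   ≈⟨ contract-decomposition (suc m) Q z f≈v ⟩
      S v₀ v₁ z                ≈⟨ +-≈0 (*-≈0ˡ _ Q⟨v₀⟩≈0) (*-≈0ˡ _ Q⟨v₁⟩≈0) ⟩
      0#                       ∎
    vanishes-at : ∀ x₀ x₁ → (∀ z → S x₀ x₁ z ≈ 0#) → det x₁ x₀ ≉ 0# → Q ⟨ x₀ ⟩ ≈ 0#
    vanishes-at x₀ x₁ S≈0 d≉0 = *-cancelʳ-≈0 power≉0 (begin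
      Q ⟨ x₀ ⟩ * pow (dot (perp x₁) x₀) (suc m)          ≈⟨ +-identityʳ _ ⟨
      Q ⟨ x₀ ⟩ * pow (dot (perp x₁) x₀) (suc m) + 0#     ≈⟨ +-congˡ (*-≈0ʳ _ (*-≈0ˡ _ (dot-perp-self x₁))) ⟨
      S x₀ x₁ (perp x₁)                                ≈⟨ S≈0 (perp x₁) ⟩
      0#                                               ∎)
      where
      power≉0 : pow (dot (perp x₁) x₀) (suc m) ≉ 0#
      power≉0 = pow-≉0 (suc m) (λ dot≈0 → d≉0 (trans (sym (dot-perp x₁ x₀)) dot≈0))

  θ-unique : ∀ m {f v₀ v₁ w₀ w₁} → Decomp (suc (suc (suc m))) f v₀ v₁ → Decomp (suc (suc (suc m))) f w₀ w₁ →
             θ v₀ v₁ ≈ θ w₀ w₁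
  θ-unique m {f} {v₀} {v₁} {w₀} {w₁} (v-indep , f≈v) (w-indep , f≈w) =
    cross-multiplied⇒θ≈θ v₀ v₁ w₀ w₁ dv≉0 dw≉0 (begin
    dot v₀ v₁ * dot v₀ v₁ * (det w₀ w₁ * det w₀ w₁)
      ≈⟨ *-cong (*-cong (tr-vanishingForm v₀ v₁) (tr-vanishingForm v₀ v₁)) (disc-vanishingForm w₀ w₁) ⟨
    tr P * tr P * disc Q
      ≈⟨ proportional-cross P Q (vanishing⇒proportional P w₀ w₁ dw≉0 (proj₁ P⟨w⟩≈0) (proj₂ P⟨w⟩≈0)) ⟩
    tr Q * tr Q * disc P
      ≈⟨ *-cong (*-cong (tr-vanishingForm w₀ w₁) (tr-vanishingForm w₀ w₁)) (disc-vanishingForm v₀ v₁) ⟩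
    dot w₀ w₁ * dot w₀ w₁ * (det v₀ v₁ * det v₀ v₁)
      ∎)
    where
    P = vanishingForm v₀ v₁
    Q = vanishingForm w₀ w₁
    dv≉0 : det v₀ v₁ ≉ 0#
    dv≉0 = LinIndep⇒det≉0 {v₀} {v₁} v-indep
    dw≉0 : det w₀ w₁ ≉ 0#
    dw≉0 = LinIndep⇒det≉0 {w₀} {w₁} w-indep
    P⟨w⟩≈0 : P ⟨ w₀ ⟩ ≈ 0# × P ⟨ w₁ ⟩ ≈ 0#
    P⟨w⟩≈0 = vanishing-transfer m P f≈v f≈w (vanishingForm-⟨₀⟩ v₀ v₁) (vanishingForm-⟨₁⟩ v₀ v₁) dw≉0

  thetaIs-orthogonal : ∀ n {H k β x₀ x₁ t} (f : Sig n) → 3 ℕ.≤ n → Orthogonal H → k ≉ 0# → β ≉ 0# →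
    det x₀ x₁ ≉ 0# → θ x₀ x₁ ≈ t → f ≈ₛ (k ·ₛ act n H (tensorPow n x₀ +ₛ (β ·ₛ tensorPow n x₁))) → ThetaIs n f t
  thetaIs-orthogonal (suc (suc (suc m))) f (ℕ.s≤s (ℕ.s≤s (ℕ.s≤s _))) H-orth k≉0 β≉0 d≉0 θx≈t f≈ =
    let v₀ , v₁ , v-decomp , θv≈θx = orthogonal-decomposition (suc (suc m)) f H-orth k≉0 β≉0 d≉0 f≈ in
    (v₀ , v₁ , v-decomp) ,
    λ w₀ w₁ w-decomp → trans (sym (θ-unique m {f} {v₀} {v₁} {w₀} {w₁} v-decomp w-decomp)) (trans θv≈θx θx≈t)

  det-±≉0 : ∀ {y} → y ≉ 0# → det (vec2 1# y) (vec2 1# (- y)) ≉ 0#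
  det-±≉0 {y} y≉0 d≈0 = *-≉0 two≉0 y≉0 (trans
    (solve 1 (λ y → con (+ 2) :* y := con (+ 1) :* y :- con (+ 1) :* (:- y)) refl y) d≈0)

  θ-± : ∀ y {t} → y ≉ 0# → (1# - y * y) * (1# - y * y) ≈ t * (four * (y * y)) → θ (vec2 1# y) (vec2 1# (- y)) ≈ t
  θ-± y {t} y≉0 eq = dot²≈t*det²⇒θ≈t (vec2 1# y) (vec2 1# (- y)) (det-±≉0 y≉0) (begin
    N * N                           ≈⟨ *-cong N≈ N≈ ⟩
    (1# - y * y) * (1# - y * y)     ≈⟨ eq ⟩
    t * (four * (y * y))            ≈⟨ *-congˡ 4y²≈d² ⟩
    t * (d * d)                     ∎)
    where
    N = dot (vec2 1# y) (vec2 1# (- y))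
    d = det (vec2 1# y) (vec2 1# (- y))
    N≈ : N ≈ 1# - y * y
    N≈ = solve 1 (λ y → con (+ 1) :* con (+ 1) :+ y :* (:- y) := con (+ 1) :- y :* y) refl y
    4y²≈d² : four * (y * y) ≈ d * d
    4y²≈d² = solve 1 (λ y → let d = con (+ 1) :* y :- con (+ 1) :* (:- y) in con (+ 2) :* con (+ 2) :* (y :* y) := d :* d)
      refl y

  θ-P1 : θ (vec2 1# 1#) (vec2 1# (- 1#)) ≈ 0#
  θ-P1 = θ-± 1# 1≉0 (solve 0 ((con (+ 1) :- con (+ 1) :* con (+ 1)) :* (con (+ 1) :- con (+ 1) :* con (+ 1))
                              := con (+ 0) :* (con (+ 2) :* con (+ 2) :* (con (+ 1) :* con (+ 1)))) refl)

  module _ {i} (i²≈-1 : i * i ≈ - 1#) where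
    i≉0 : i ≉ 0#
    i≉0 i≈0 = -1≉0 (trans (sym i²≈-1) (*-≈0ˡ i i≈0))

    i²+1≈0 : i * i + 1# ≈ 0#
    i²+1≈0 = trans (+-congʳ i²≈-1) (-‿inverseˡ 1#)

    θ-A2 : θ (vec2 1# i) (vec2 1# (- i)) ≈ - 1#
    θ-A2 = θ-± i i≉0 (x-y≈0⇒x≈y _ _ (trans
      (solve 1 (λ i → (con (+ 1) :- i :* i) :* (con (+ 1) :- i :* i) :- (:- con (+ 1)) :* (con (+ 2) :* con (+ 2) :* (i :* i))
                        := (i :* i :+ con (+ 1)) :* (i :* i :+ con (+ 1))) refl i)
      (*-≈0ˡ _ i²+1≈0)))

    module _ {s} (s²≈2 : s * s ≈ two) where
      private
        α = (1# + i) * s ⁻¹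

      α²≈i : α * α ≈ i
      α²≈i = x-y≈0⇒x≈y _ _ (trans
        (solve 3 (λ i s s⁻¹ → (con (+ 1) :+ i) :* s⁻¹ :* ((con (+ 1) :+ i) :* s⁻¹) :- i
           := (i :* i :+ con (+ 1)) :* (s⁻¹ :* s⁻¹)
              :+ i :* ((s :* s⁻¹ :- con (+ 1)) :* (s :* s⁻¹ :+ con (+ 1)) :+ (:- (s :* s :- con (+ 2))) :* (s⁻¹ :* s⁻¹)))
          refl i s (s ⁻¹))
        (+-≈0 (*-≈0ˡ _ i²+1≈0)
              (*-≈0ʳ i (+-≈0 (*-≈0ˡ _ (x≈y⇒x-y≈0 (inverse s s≉0))) (*-≈0ˡ _ (-‿≈0 (x≈y⇒x-y≈0 s²≈2)))))))
        where
        s≉0 : s ≉ 0#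
        s≉0 s≈0 = two≉0 (trans (sym s²≈2) (*-≈0ˡ s s≈0))

      α≉0 : α ≉ 0#
      α≉0 α≈0 = i≉0 (trans (sym α²≈i) (*-≈0ˡ α α≈0))

      θ-A3 : θ (vec2 1# α) (vec2 1# (- α)) ≈ - (two ⁻¹)
      θ-A3 = θ-± α α≉0 (begin
        (1# - α * α) * (1# - α * α)       ≈⟨ *-cong (+-congˡ (-‿cong α²≈i)) (+-congˡ (-‿cong α²≈i)) ⟩
        (1# - i) * (1# - i)               ≈⟨ x-y≈0⇒x≈y _ _ (trans
            (solve 2 (λ i h → (con (+ 1) :- i) :* (con (+ 1) :- i) :- (:- h) :* (con (+ 2) :* con (+ 2) :* i)
               := (i :* i :+ con (+ 1)) :+ con (+ 2) :* i :* (con (+ 2) :* h :- con (+ 1))) refl i (two ⁻¹))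
            (+-≈0 i²+1≈0 (*-≈0ʳ _ (x≈y⇒x-y≈0 (inverse two two≉0))))) ⟩
        - (two ⁻¹) * (four * i)           ≈⟨ *-congˡ (*-congˡ α²≈i) ⟨
        - (two ⁻¹) * (four * (α * α))     ∎)

mainTheorem3 : ∀ {c ℓ} (K : ComplexField c ℓ) →
    let open ComplexField K in
    let open Signatures K in
    (i s : Carrier) → (i * i) ≈ (- 1#) → (s * s) ≈ (1# + 1#) →
    let α = (1# + i) * (s ⁻¹) in
    (n : ℕ) → 3 ≤ n → (f : Sig n) → Symmetric f → ¬ Degenerate n f →
    (InP1 n f → ThetaIs n f 0#)
    × (InA2 i n f → ThetaIs n f (- 1#))
    × (InA3 i α n f → ThetaIs n f (- ((1# + 1#) ⁻¹)))
mainTheorem3 K i s i²≈-1 s²≈2 n 3≤n f _ _ = inP1 , inA2 , inA3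
  where
  open ComplexField K hiding (zero)
  open Signatures K
  open Theta K
  inP1 : InP1 n f → ThetaIs n f 0#
  inP1 (H , k , β , H-orth , k≉0 , β≉0 , f≈) =
    thetaIs-orthogonal n f 3≤n H-orth k≉0 β≉0 (det-±≉0 1≉0) θ-P1 f≈
  inA2 : InA2 i n f → ThetaIs n f (- 1#)
  inA2 (H , k , H-orth , k≉0 , f≈) =
    thetaIs-orthogonal n f 3≤n H-orth k≉0 1≉0 (det-±≉0 (i≉0 i²≈-1)) (θ-A2 i²≈-1)
      (λ x → trans (f≈ x) (*-congˡ (act-cong n H (λ y → +-congˡ (sym (*-identityˡ _))) x)))
  inA3 : InA3 i ((1# + i) * s ⁻¹) n f → ThetaIs n f (- (two ⁻¹))
  inA3 (H , k , r , H-orth , k≉0 , f≈) =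
    thetaIs-orthogonal n f 3≤n H-orth k≉0 (pow-≉0 (toℕ r) (i≉0 i²≈-1))
      (det-±≉0 (α≉0 i²≈-1 s²≈2)) (θ-A3 i²≈-1 s²≈2) f≈
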